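{- Let $N$ be a positive perfect square, and let $H$ be the undirected unweighted graph defined as follows. With indices $i,j,x,y$ ranging over $[\sqrt N]=\{1,\dots,\sqrt N\}$ and $k,z$ over $\{0,1\}$, the vertex set is the disjoint union of $A=\{a[i,j]\}$, $B=\{b[i,j,k]\}$, $C=\{c[i,j,k]\}$, $D=\{d[i,j]\}$ (of sizes $N,2N,2N,N$). The edges are exactly: $\{b[i,j,k],b[x,y,z]\}$ iff exactly one of $i=x$, $j=y$ holds; $\{c[i,j,k],c[x,y,z]\}$ iff exactly one of $i=x$, $j=y$ holds; $\{a[i,j],b[x,y,z]\}$ iff $i=x$ and $z=0$; $\{b[i,j,k],c[x,y,z]\}$ iff $i=x$ and $j=y$; $\{c[i,j,k],d[x,y]\}$ iff $j=y$ and $k=0$. There are no edges inside $A$, inside $D$, or between $A$ and $C$, $A$ and $D$, or $B$ and $D$. Then the diameter of $H$ is at most $3$.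
   Context: The diameter of an unweighted graph is the maximum, over all vertex pairs, of the number of edges on a shortest path between them. -}

module Defs where

open import Data.Nat using (ℕ; zero; suc; _≤_)
open import Data.Fin using (Fin; zero)
open import Data.Empty using (⊥)
open import Data.Product using (_×_; Σ)
open import Data.Sum using (_⊎_)
open import Relation.Nullary using (¬_)
open import Relation.Binary.PropositionalEquality using (_≡_)

-- Bits: k, z ∈ {0,1} encoded as Fin 2 (zero = 0).
-- Indices i, j, x, y ∈ [√N] encoded as Fin n where n = √N.

data Vertex (n : ℕ) : Set where
  a : Fin n → Fin n → Vertex n
  b : Fin n → Fin n → Fin 2 → Vertex n
  c : Fin n → Fin n → Fin 2 → Vertex n
  d : Fin n → Fin n → Vertex n

ExactlyOne : Set → Set → Set
ExactlyOne P Q = (P × ¬ Q) ⊎ (¬ P × Q)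

-- Directed description of the edge rules; the graph's adjacency is its symmetric closure.
Edge : {n : ℕ} → Vertex n → Vertex n → Set
Edge (b i j k) (b x y z) = ExactlyOne (i ≡ x) (j ≡ y)
Edge (c i j k) (c x y z) = ExactlyOne (i ≡ x) (j ≡ y)
Edge (a i j)   (b x y z) = (i ≡ x) × (z ≡ zero)
Edge (b i j k) (c x y z) = (i ≡ x) × (j ≡ y)
Edge (c i j k) (d x y)   = (j ≡ y) × (k ≡ zero)
Edge _ _ = ⊥

Adj : {n : ℕ} → Vertex n → Vertex n → Set
Adj u v = Edge u v ⊎ Edge v u

data Walk {n : ℕ} : Vertex n → Vertex n → ℕ → Set where
  [] : ∀ {u} → Walk u u 0
  _∷_ : ∀ {u v w ℓ} → Adj u v → Walk v w ℓ → Walk u w (suc ℓ)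

-- dist(u,v) ≤ ℓ : some walk (hence some shortest path) of length ≤ ℓ
DistLe : {n : ℕ} → Vertex n → Vertex n → ℕ → Set
DistLe u v ℓ = Σ ℕ (λ m → m ≤ ℓ × Walk u v m)

DiameterLe : (n : ℕ) → ℕ → Set
DiameterLe n ℓ = (u v : Vertex n) → DistLe u v ℓ

{-# OPTIONS --safe #-}
-- B and C are each a rook's graph on the grid with doubled cells: two of their
-- vertices in different cells are adjacent when the cells share a row or column and
-- otherwise joined through b[i,y,0] (resp. c[i,y,0]), while the two copies of a
-- cell are joined through the matching vertex of the other layer, since b[i,j,k]
-- and c[i,j,z] are always adjacent. A-vertices hang off the bit-0 B-vertices of
-- their row and D-vertices off the bit-0 C-vertices of their column, so every
-- pair is joined by a walk of length at most 3.
module Submission where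

open import Defs
open import Data.Nat using (ℕ; suc; _≤?_)
open import Data.Fin using (Fin; zero)
open import Data.Fin.Properties using (_≟_)
open import Data.Product using (_,_)
open import Data.Sum using (inj₁; inj₂)
open import Relation.Nullary using (yes; no)
open import Relation.Nullary.Decidable using (True; toWitness)
open import Relation.Binary.PropositionalEquality using (refl; _≢_)

module _ {n : ℕ} where

  Adj-sym : {u v : Vertex n} → Adj u v → Adj v u
  Adj-sym (inj₁ e) = inj₂ e
  Adj-sym (inj₂ e) = inj₁ e

  _∷ʳ_ : ∀ {u v w ℓ} → Walk {n} u v ℓ → Adj v w → Walk u w (suc ℓ)
  []      ∷ʳ e = e ∷ []
  (f ∷ p) ∷ʳ e = f ∷ (p ∷ʳ e)

  reverse : ∀ {u v ℓ} → Walk {n} u v ℓ → Walk v u ℓ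
  reverse []      = []
  reverse (e ∷ p) = reverse p ∷ʳ Adj-sym e

  DistLe-sym : ∀ {u v : Vertex n} {ℓ} → DistLe u v ℓ → DistLe v u ℓ
  DistLe-sym (m , m≤ℓ , p) = m , m≤ℓ , reverse p

  walk⇒DistLe : ∀ {u v : Vertex n} {m ℓ} → Walk u v m → {m≤ℓ : True (m ≤? ℓ)} → DistLe u v ℓ
  walk⇒DistLe {m = m} p {m≤ℓ} = m , toWitness m≤ℓ , p

  -- Edge rules are phrased as extensions of walks rather than as Adj facts because
  -- Adj does not determine its endpoints, whereas Walk indices do.
  module _ {i j : Fin n} {w : Vertex n} {ℓ : ℕ} where

    a→b : ∀ {y} → Walk (b i y zero) w ℓ → Walk (a i j) w (suc ℓ)
    a→b p = inj₁ (refl , refl) ∷ p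

    b→a : ∀ {y} → Walk (a i j) w ℓ → Walk (b i y zero) w (suc ℓ)
    b→a p = inj₂ (refl , refl) ∷ p

    b→c : ∀ {k z} → Walk (c i j z) w ℓ → Walk (b i j k) w (suc ℓ)
    b→c p = inj₁ (refl , refl) ∷ p

    c→b : ∀ {k z} → Walk (b i j z) w ℓ → Walk (c i j k) w (suc ℓ)
    c→b p = inj₂ (refl , refl) ∷ p

    c→d : ∀ {x} → Walk (d x j) w ℓ → Walk (c i j zero) w (suc ℓ)
    c→d p = inj₁ (refl , refl) ∷ p

    d→c : ∀ {x} → Walk (c i j zero) w ℓ → Walk (d x j) w (suc ℓ)
    d→c p = inj₂ (refl , refl) ∷ p

  module _ {i j : Fin n} {k z : Fin 2} {w : Vertex n} {ℓ : ℕ} where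

    b→b-row : ∀ {y} → j ≢ y → Walk (b i y z) w ℓ → Walk (b i j k) w (suc ℓ)
    b→b-row j≢y p = inj₁ (inj₁ (refl , j≢y)) ∷ p

    b→b-col : ∀ {x} → i ≢ x → Walk (b x j z) w ℓ → Walk (b i j k) w (suc ℓ)
    b→b-col i≢x p = inj₁ (inj₂ (i≢x , refl)) ∷ p

    c→c-row : ∀ {y} → j ≢ y → Walk (c i y z) w ℓ → Walk (c i j k) w (suc ℓ)
    c→c-row j≢y p = inj₁ (inj₁ (refl , j≢y)) ∷ p

    c→c-col : ∀ {x} → i ≢ x → Walk (c x j z) w ℓ → Walk (c i j k) w (suc ℓ)
    c→c-col i≢x p = inj₁ (inj₂ (i≢x , refl)) ∷ p

  module _ (i j x y : Fin n) where

    distLe-a-a : DistLe (a i j) (a x y) 3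
    distLe-a-a with i ≟ x
    ... | yes refl = walk⇒DistLe (a→b {y = j} (b→a []))
    ... | no i≢x   = walk⇒DistLe (a→b {y = j} (b→b-col i≢x (b→a [])))

    distLe-a-b : ∀ z → DistLe (a i j) (b x y z) 3
    distLe-a-b z with i ≟ x
    ... | yes refl = walk⇒DistLe (a→b (b→c {z = zero} (c→b [])))
    ... | no i≢x   = walk⇒DistLe (a→b (b→b-col i≢x []))

    distLe-a-c : ∀ z → DistLe (a i j) (c x y z) 3
    distLe-a-c z with i ≟ x
    ... | yes refl = walk⇒DistLe (a→b (b→c []))
    ... | no i≢x   = walk⇒DistLe (a→b (b→b-col {z = zero} i≢x (b→c [])))

    distLe-a-d : DistLe (a i j) (d x y) 3
    distLe-a-d = walk⇒DistLe (a→b (b→c (c→d [])))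

    distLe-b-b : ∀ k z → DistLe (b i j k) (b x y z) 3
    distLe-b-b k z with i ≟ x | j ≟ y
    ... | yes refl | yes refl = walk⇒DistLe (b→c {z = zero} (c→b []))
    ... | yes refl | no j≢y   = walk⇒DistLe (b→b-row j≢y [])
    ... | no i≢x   | yes refl = walk⇒DistLe (b→b-col i≢x [])
    ... | no i≢x   | no j≢y   = walk⇒DistLe (b→b-row {z = zero} j≢y (b→b-col i≢x []))

    distLe-b-c : ∀ k z → DistLe (b i j k) (c x y z) 3
    distLe-b-c k z with i ≟ x | j ≟ y
    ... | yes refl | yes refl = walk⇒DistLe (b→c [])
    ... | yes refl | no j≢y   = walk⇒DistLe (b→c {z = zero} (c→c-row j≢y []))
    ... | no i≢x   | yes refl = walk⇒DistLe (b→c {z = zero} (c→c-col i≢x []))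
    ... | no i≢x   | no j≢y   =
      walk⇒DistLe (b→b-row {z = zero} j≢y (b→c {z = zero} (c→c-col i≢x [])))

    distLe-b-d : ∀ k → DistLe (b i j k) (d x y) 3
    distLe-b-d k with j ≟ y
    ... | yes refl = walk⇒DistLe (b→c (c→d []))
    ... | no j≢y   = walk⇒DistLe (b→b-row {z = zero} j≢y (b→c (c→d [])))

    distLe-c-c : ∀ k z → DistLe (c i j k) (c x y z) 3
    distLe-c-c k z with i ≟ x | j ≟ y
    ... | yes refl | yes refl = walk⇒DistLe (c→b {z = zero} (b→c []))
    ... | yes refl | no j≢y   = walk⇒DistLe (c→c-row j≢y [])
    ... | no i≢x   | yes refl = walk⇒DistLe (c→c-col i≢x [])
    ... | no i≢x   | no j≢y   = walk⇒DistLe (c→c-row {z = zero} j≢y (c→c-col i≢x []))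

    distLe-c-d : ∀ k → DistLe (c i j k) (d x y) 3
    distLe-c-d k with j ≟ y
    ... | yes refl = walk⇒DistLe (c→b {z = zero} (b→c (c→d [])))
    ... | no j≢y   = walk⇒DistLe (c→c-row j≢y (c→d []))

    distLe-d-d : DistLe (d i j) (d x y) 3
    distLe-d-d with j ≟ y
    ... | yes refl = walk⇒DistLe (d→c {i = i} (c→d []))
    ... | no j≢y   = walk⇒DistLe (d→c {i = i} (c→c-row j≢y (c→d [])))

diameterLe-3 : (n : ℕ) → DiameterLe n 3
diameterLe-3 n (a i j)   (a x y)   = distLe-a-a i j x y
diameterLe-3 n (a i j)   (b x y z) = distLe-a-b i j x y z
diameterLe-3 n (a i j)   (c x y z) = distLe-a-c i j x y z
diameterLe-3 n (a i j)   (d x y)   = distLe-a-d i j x y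
diameterLe-3 n (b i j k) (a x y)   = DistLe-sym (distLe-a-b x y i j k)
diameterLe-3 n (b i j k) (b x y z) = distLe-b-b i j x y k z
diameterLe-3 n (b i j k) (c x y z) = distLe-b-c i j x y k z
diameterLe-3 n (b i j k) (d x y)   = distLe-b-d i j x y k
diameterLe-3 n (c i j k) (a x y)   = DistLe-sym (distLe-a-c x y i j k)
diameterLe-3 n (c i j k) (b x y z) = DistLe-sym (distLe-b-c x y i j z k)
diameterLe-3 n (c i j k) (c x y z) = distLe-c-c i j x y k z
diameterLe-3 n (c i j k) (d x y)   = distLe-c-d i j x y k
diameterLe-3 n (d i j)   (a x y)   = DistLe-sym (distLe-a-d x y i j)
diameterLe-3 n (d i j)   (b x y z) = DistLe-sym (distLe-b-d x y i j z)
diameterLe-3 n (d i j)   (c x y z) = DistLe-sym (distLe-c-d x y i j z)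
diameterLe-3 n (d i j)   (d x y)   = distLe-d-d i j x y

lemma11 : (m : ℕ) → DiameterLe (suc m) 3
lemma11 m = diameterLe-3 (suc m)
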